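{- Let $S=\{0,\ldots,p-1\}$, $m=L+1+R\ge 1$ with $L,R\ge 0$, $f:S^m\to S$, and let $\tau:S^{\mathbb Z}\to S^{\mathbb Z}$ be the global map $\tau(c)_i=f(c_{i-L},\ldots,c_{i+R})$. Then $\tau$ is injective if and only if there do not exist periodic local configurations for $f$.
   Context: For a finite word $x=x_1\cdots x_n$ with $n\ge m$, its successor under $f$ is $f(x)=y_1\cdots y_{n-m+1}$ with $y_i=f(x_i\cdots x_{i+m-1})$; $\mathrm{left}_k(x)=x_1\cdots x_k$, $\mathrm{right}_k(x)=x_{n-k+1}\cdots x_n$. Finite words $\alpha,\beta$ are periodic local configurations if each has length at least $m$, $\alpha\ne\beta$, $\mathrm{left}_{m-1}(\alpha)=\mathrm{right}_{m-1}(\alpha)$, $\mathrm{left}_{m-1}(\beta)=\mathrm{right}_{m-1}(\beta)$, and $\alpha,\beta$ have the same successor under $f$. -}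

module Defs where

open import Data.Nat using (ℕ; zero; suc; _+_; _∸_; _≥_)
open import Data.Fin using (Fin; toℕ)
open import Data.Integer as ℤ using (ℤ; +_)
open import Data.List using (List; []; _∷_; length; take; drop)
open import Data.Vec using (Vec; tabulate)
open import Data.Maybe using (Maybe; just; nothing)
open import Relation.Binary.PropositionalEquality using (_≡_; _≢_)
open import Data.Product using (_×_)

S : ℕ → Set
S p = Fin p

Config : ℕ → Set
Config p = ℤ → S p

nbhd : ℕ → ℕ → ℕ
nbhd L R = L + 1 + R

τ : ∀ {p} L R → (Vec (S p) (nbhd L R) → S p) → Config p → Config p
τ L R f c i = f (tabulate (λ j → c ((i ℤ.- + L) ℤ.+ + toℕ j)))

InjectiveCA : ∀ {p} → (Config p → Config p) → Set
InjectiveCA {p} T = (c d : Config p) → (∀ i → T c i ≡ T d i) → ∀ i → c i ≡ d i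

prefixVec : ∀ {A : Set} (n : ℕ) → List A → Maybe (Vec A n)
prefixVec zero xs = just Data.Vec.[]
prefixVec (suc n) [] = nothing
prefixVec (suc n) (x ∷ xs) with prefixVec n xs
... | just v = just (x Data.Vec.∷ v)
... | nothing = nothing

-- Successor of a finite word x_1…x_n under a local rule f of arity m:
-- y_1…y_{n-m+1} with y_i = f(x_i…x_{i+m-1}) (empty if n < m).
successor : ∀ {A : Set} {m} → (Vec A m → A) → List A → List A
successor f [] = []
successor {m = m} f (x ∷ xs) with prefixVec m (x ∷ xs)
... | just v = f v ∷ successor f xs
... | nothing = []

left : ∀ {A : Set} → ℕ → List A → List A
left k x = take k x

right : ∀ {A : Set} → ℕ → List A → List A
right k x = drop (length x ∸ k) x

PeriodicLocalConfigs : ∀ {p m} → (Vec (S p) m → S p) → List (S p) → List (S p) → Set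
PeriodicLocalConfigs {m = m} f α β =
  length α ≥ m × length β ≥ m × α ≢ β ×
  left (m ∸ 1) α ≡ right (m ∸ 1) α ×
  left (m ∸ 1) β ≡ right (m ∸ 1) β ×
  successor f α ≡ successor f β

-- If α ≠ β are periodic local configurations, repeating them with period |α| − (m − 1) gives two
-- distinct configurations with the same image, so τ is not injective.  Conversely, let c, d have
-- the same image and fix a cell.  The pair of length-(m − 1) windows of c and d at a position takes
-- at most p^(2(m − 1)) values, so it repeats both to the left and to the right of the cell.  If c
-- and d differ between two repeating positions a < b, their words from a to b + m − 1 are periodic
-- local configurations.  Otherwise c and d have agreeing windows at some a left and some b right of
-- the cell, and if they differ at the cell, then c[a, b + m − 1) followed by c[a, a + m − 1), and
-- the same word for d, are periodic local configurations.
module Submission where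

open import Defs
open import Data.Nat using (ℕ)
open import Data.Vec using (Vec)
open import Data.List using (List)
open import Data.Product using (∃₂)
open import Relation.Nullary using (¬_)
open import Function.Bundles using (_⇔_)

open import Data.Nat using (zero; suc; _+_; _∸_; _*_; _^_; _≤_; _<_; z≤n; s≤s)
open import Data.Nat.Properties
open import Data.Nat.DivMod using (_%_; _/_; m≡m%n+[m/n]*n; m%n<n; n%n≡0; [m+n]%n≡m%n; %-distribˡ-+; m%n%n≡m%n)
open import Algebra.Properties.CommutativeSemigroup +-commutativeSemigroup using (x∙yz≈y∙xz)
open import Data.Integer as ℤ using (ℤ; +_; -[1+_]; 1ℤ)
import Data.Integer.Properties as ℤP
open import Data.Fin as F using (Fin; toℕ)
import Data.Fin.Properties as FP
open import Data.List using ([]; _∷_; length; take; drop; _++_)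
import Data.List.Properties as LP
open import Data.Vec as V using (tabulate)
import Data.Vec.Properties as VP
open import Data.Maybe using (just; nothing)
open import Data.Product using (∃; _×_; _,_; proj₁; proj₂)
open import Relation.Binary.PropositionalEquality
open import Relation.Nullary.Decidable using (decidable-stable)
open import Function.Bundles using (mk⇔)
import Function.Properties.Equivalence as ⇔

module _ {A : Set} where

  slice : (ℕ → A) → ℕ → ℕ → List A
  slice C a zero    = []
  slice C a (suc n) = C a ∷ slice C (suc a) n

  length-slice : ∀ C a n → length (slice C a n) ≡ n
  length-slice C a zero    = refl
  length-slice C a (suc n) = cong suc (length-slice C (suc a) n)

  ≤-length-slice : ∀ C a {m n} → m ≤ n → m ≤ length (slice C a n)
  ≤-length-slice C a {m} {n} = subst (m ≤_) (sym (length-slice C a n))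

  slice-cong : ∀ {C D : ℕ → A} a b n → (∀ t → t < n → C (a + t) ≡ D (b + t)) →
               slice C a n ≡ slice D b n
  slice-cong         a b zero    _  = refl
  slice-cong {C} {D} a b (suc n) eq = cong₂ _∷_ head (slice-cong (suc a) (suc b) n tail)
    where
      head : C a ≡ D b
      head = subst₂ (λ x y → C x ≡ D y) (+-identityʳ a) (+-identityʳ b) (eq 0 (s≤s z≤n))
      tail : ∀ t → t < n → C (suc a + t) ≡ D (suc b + t)
      tail t t<n = subst₂ (λ x y → C x ≡ D y) (+-suc a t) (+-suc b t) (eq (suc t) (s≤s t<n))

  slice-pointwise : ∀ {C D : ℕ → A} a b n → slice C a n ≡ slice D b n →
                    ∀ t → t < n → C (a + t) ≡ D (b + t)
  slice-pointwise {C} {D} a b (suc n) eq zero    _ =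
    subst₂ (λ x y → C x ≡ D y) (sym (+-identityʳ a)) (sym (+-identityʳ b)) (LP.∷-injectiveˡ eq)
  slice-pointwise {C} {D} a b (suc n) eq (suc t) (s≤s t<n) =
    subst₂ (λ x y → C x ≡ D y) (sym (+-suc a t)) (sym (+-suc b t))
      (slice-pointwise (suc a) (suc b) n (LP.∷-injectiveʳ eq) t t<n)

  slice-+ : ∀ C a m n → slice C a (m + n) ≡ slice C a m ++ slice C (a + m) n
  slice-+ C a zero    n = cong (λ x → slice C x n) (sym (+-identityʳ a))
  slice-+ C a (suc m) n = cong (C a ∷_)
    (trans (slice-+ C (suc a) m n) (cong (λ x → slice C (suc a) m ++ slice C x n) (sym (+-suc a m))))

  take-slice : ∀ C a {m n} → m ≤ n → take m (slice C a n) ≡ slice C a m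
  take-slice C a {zero}  _         = refl
  take-slice C a {suc m} (s≤s m≤n) = cong (C a ∷_) (take-slice C (suc a) m≤n)

  take-++ˡ : ∀ (xs ys : List A) {m} → m ≤ length xs → take m (xs ++ ys) ≡ take m xs
  take-++ˡ xs       ys {zero}  _         = refl
  take-++ˡ (x ∷ xs) ys {suc m} (s≤s m≤n) = cong (x ∷_) (take-++ˡ xs ys m≤n)

  take-slice-++ : ∀ C a {m n} ys → m ≤ n → take m (slice C a n ++ ys) ≡ slice C a m
  take-slice-++ C a {n = n} ys m≤n =
    trans (take-++ˡ (slice C a n) ys (≤-length-slice C a m≤n)) (take-slice C a m≤n)

  right-++ : ∀ (xs ys : List A) → right (length ys) (xs ++ ys) ≡ ys
  right-++ xs ys rewrite LP.length-++ xs {ys} | m+n∸n≡m (length xs) (length ys) = drop-length xs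
    where
      drop-length : ∀ xs → drop (length xs) (xs ++ ys) ≡ ys
      drop-length []       = refl
      drop-length (x ∷ xs) = drop-length xs

  right-slice-++ : ∀ xs C a n → right n (xs ++ slice C a n) ≡ slice C a n
  right-slice-++ xs C a n = subst (λ l → right l (xs ++ slice C a n) ≡ slice C a n)
                                  (length-slice C a n) (right-++ xs (slice C a n))

  left≡right-slice : ∀ C a m n → slice C a n ≡ slice C (a + m) n →
                     left n (slice C a (m + n)) ≡ right n (slice C a (m + n))
  left≡right-slice C a m n eq = begin
    take n (slice C a (m + n))                 ≡⟨ take-slice C a (m≤n+m n m) ⟩
    slice C a n                                ≡⟨ eq ⟩
    slice C (a + m) n                          ≡⟨ right-slice-++ (slice C a m) C (a + m) n ⟨
    right n (slice C a m ++ slice C (a + m) n) ≡⟨ cong (right n) (slice-+ C a m n) ⟨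
    right n (slice C a (m + n))                ∎
    where open ≡-Reasoning

  at : A → List A → ℕ → A
  at d []       _       = d
  at d (x ∷ xs) zero    = x
  at d (x ∷ xs) (suc s) = at d xs s

  slice-at : ∀ d xs {n} → length xs ≡ n → slice (at d xs) 0 n ≡ xs
  slice-at d []       refl = refl
  slice-at d (x ∷ xs) refl =
    cong (x ∷_) (trans (slice-cong 1 0 (length xs) (λ _ _ → refl)) (slice-at d xs refl))

  at-take : ∀ d xs {k t} → t < k → at d (take k xs) t ≡ at d xs t
  at-take d []       {suc k}         _         = refl
  at-take d (x ∷ xs) {suc k} {zero}  _         = refl
  at-take d (x ∷ xs) {suc k} {suc t} (s≤s t<k) = at-take d xs t<k

  at-drop : ∀ d xs n t → at d (drop n xs) t ≡ at d xs (n + t)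
  at-drop d xs       zero    t = refl
  at-drop d []       (suc n) t = refl
  at-drop d (x ∷ xs) (suc n) t = at-drop d xs n t

  window : ∀ m → (ℕ → A) → ℕ → Vec A m
  window m C a = tabulate (λ j → C (a + toℕ j))

  localImage : ∀ {m} → (Vec A m → A) → (ℕ → A) → ℕ → A
  localImage {m} f C a = f (window m C a)

  prefixVec-slice : ∀ m C a {n} → m ≤ n → prefixVec m (slice C a n) ≡ just (window m C a)
  prefixVec-slice zero    C a _ = refl
  prefixVec-slice (suc m) C a {suc n} (s≤s m≤n) rewrite prefixVec-slice m C (suc a) m≤n =
    cong just (cong₂ V._∷_ (cong C (sym (+-identityʳ a)))
                           (VP.tabulate-cong (λ j → cong C (sym (+-suc a (toℕ j))))))

  prefixVec-short : ∀ m (xs : List A) → length xs < m → prefixVec m xs ≡ nothing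
  prefixVec-short (suc m) []       _        = refl
  prefixVec-short (suc m) (x ∷ xs) (s≤s lt) rewrite prefixVec-short m xs lt = refl

  prefixVec-long : ∀ m (xs : List A) → m ≤ length xs → ∃ λ v → prefixVec m xs ≡ just v
  prefixVec-long zero    xs       _ = V.[] , refl
  prefixVec-long (suc m) (x ∷ xs) (s≤s m≤n) with prefixVec-long m xs m≤n
  ... | v , eq rewrite eq = x V.∷ v , refl

  prefixVec-++ : ∀ m (xs ys : List A) → m ≤ length xs → prefixVec m (xs ++ ys) ≡ prefixVec m xs
  prefixVec-++ zero    xs       ys _         = refl
  prefixVec-++ (suc m) (x ∷ xs) ys (s≤s m≤n) rewrite prefixVec-++ m xs ys m≤n = refl

  module _ {m} (f : Vec A m → A) where

    successor-∷ : ∀ x xs {v} → prefixVec m (x ∷ xs) ≡ just v →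
                  successor f (x ∷ xs) ≡ f v ∷ successor f xs
    successor-∷ x xs eq rewrite eq = refl

    successor-short : ∀ xs → length xs < m → successor f xs ≡ []
    successor-short []       _  = refl
    successor-short (x ∷ xs) lt rewrite prefixVec-short m (x ∷ xs) lt = refl

  module _ {k} (f : Vec A (suc k) → A) where

    successor-slice : ∀ C a n → successor f (slice C a (suc n + k)) ≡ slice (localImage f C) a (suc n)
    successor-slice C a n =
      trans (successor-∷ f (C a) (slice C (suc a) (n + k)) (prefixVec-slice (suc k) C a (s≤s (m≤n+m k n))))
            (cong (localImage f C a ∷_) (successor-tail n))
      where
        successor-tail : ∀ n → successor f (slice C (suc a) (n + k)) ≡ slice (localImage f C) (suc a) n
        successor-tail zero    =
          successor-short f (slice C (suc a) k) (s≤s (≤-reflexive (length-slice C (suc a) k)))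
        successor-tail (suc n) = successor-slice C (suc a) n

    successor-at : ∀ d xs n → length xs ≡ suc n + k →
                   successor f xs ≡ slice (localImage f (at d xs)) 0 (suc n)
    successor-at d xs n len = trans (cong (successor f) (sym (slice-at d xs len))) (successor-slice (at d xs) 0 n)

    length-successor : ∀ xs n → length xs ≡ suc n + k → length (successor f xs) ≡ suc n
    length-successor (x ∷ xs) n len =
      trans (cong length (successor-at x (x ∷ xs) n len)) (length-slice _ 0 (suc n))

    successor-++ : ∀ xs ys zs → length ys ≡ k →
                   successor f (xs ++ ys ++ zs) ≡ successor f (xs ++ ys) ++ successor f (ys ++ zs)
    successor-++ []       ys zs refl = cong (_++ successor f (ys ++ zs)) (sym (successor-short f ys ≤-refl))
    successor-++ (x ∷ xs) ys zs refl = begin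
      successor f (x ∷ xs ++ ys ++ zs)                      ≡⟨ successor-∷ f x (xs ++ ys ++ zs) prefix ⟩
      f v ∷ successor f (xs ++ ys ++ zs)                    ≡⟨ cong (f v ∷_) (successor-++ xs ys zs refl) ⟩
      f v ∷ successor f (xs ++ ys) ++ successor f (ys ++ zs)
        ≡⟨ cong (_++ successor f (ys ++ zs)) (successor-∷ f x (xs ++ ys) eq) ⟨
      successor f (x ∷ xs ++ ys) ++ successor f (ys ++ zs)  ∎
      where
        open ≡-Reasoning
        long : suc (length ys) ≤ length (x ∷ xs ++ ys)
        long = s≤s (LP.length-++-≤ʳ ys {xs})
        v : Vec A (suc k)
        v = proj₁ (prefixVec-long (suc k) (x ∷ xs ++ ys) long)
        eq : prefixVec (suc k) (x ∷ xs ++ ys) ≡ just v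
        eq = proj₂ (prefixVec-long (suc k) (x ∷ xs ++ ys) long)
        prefix : prefixVec (suc k) (x ∷ xs ++ ys ++ zs) ≡ just v
        prefix = trans (cong (prefixVec (suc k)) (sym (LP.++-assoc (x ∷ xs) ys zs)))
                       (trans (prefixVec-++ (suc k) (x ∷ xs ++ ys) zs long) eq)

-- τ L R f c i is τ₀ f c (i - L) by definition.
τ₀ : ∀ {A : Set} {m} → (Vec A m → A) → (ℤ → A) → ℤ → A
τ₀ f c i = f (tabulate λ j → c (i ℤ.+ + toℕ j))

i-j+j≡i : ∀ i j → i ℤ.- j ℤ.+ j ≡ i
i-j+j≡i i j =
  trans (ℤP.+-assoc i (ℤ.- j) j) (trans (cong (λ w → i ℤ.+ w) (ℤP.+-inverseˡ j)) (ℤP.+-identityʳ i))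

i+j-j≡i : ∀ i j → i ℤ.+ j ℤ.- j ≡ i
i+j-j≡i i j =
  trans (ℤP.+-assoc i j (ℤ.- j)) (trans (cong (λ w → i ℤ.+ w) (ℤP.+-inverseʳ j)) (ℤP.+-identityʳ i))

injectiveCA-shift : ∀ {p} (T : Config p → Config p) s → InjectiveCA (λ c i → T c (i ℤ.- s)) ⇔ InjectiveCA T
injectiveCA-shift T s = mk⇔
  (λ inj c d same → inj c d λ i → same (i ℤ.- s))
  (λ inj c d same → inj c d λ i → subst (λ j → T c j ≡ T d j) (i+j-j≡i i s) (same (i ℤ.+ s)))

-- κ o i ≡ i modulo suc o: a negative i is shifted by the multiple (suc o) * ∣ i ∣.
κ : ℕ → ℤ → ℕ
κ o (+ n)    = n
κ o -[1+ n ] = o * suc n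

module _ (o : ℕ) where

  private
    P : ℕ
    P = suc o

  %-cong-suc : ∀ {x y} → x % P ≡ y % P → suc x % P ≡ suc y % P
  %-cong-suc {x} {y} eq =
    trans (%-distribˡ-+ 1 x P) (trans (cong (λ z → (1 % P + z) % P) eq) (sym (%-distribˡ-+ 1 y P)))

  %-absorbˡ-+ : ∀ x u → (x % P + u) % P ≡ (x + u) % P
  %-absorbˡ-+ x u = trans (%-distribˡ-+ (x % P) u P)
    (trans (cong (λ z → (z + u % P) % P) (m%n%n≡m%n x P)) (sym (%-distribˡ-+ x u P)))

  κ-suc : ∀ i → κ o (i ℤ.+ 1ℤ) % P ≡ suc (κ o i) % P
  κ-suc (+ n)        = cong (_% P) (+-comm n 1)
  κ-suc -[1+ zero  ] = sym (trans (cong (λ z → suc z % P) (*-identityʳ o)) (n%n≡0 P))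
  κ-suc -[1+ suc n ] = sym (begin
    suc (o * suc (suc n)) % P  ≡⟨ cong (λ z → suc z % P) (*-suc o (suc n)) ⟩
    (P + o * suc n) % P        ≡⟨ cong (_% P) (+-comm P (o * suc n)) ⟩
    (o * suc n + P) % P        ≡⟨ [m+n]%n≡m%n (o * suc n) P ⟩
    o * suc n % P              ∎)
    where open ≡-Reasoning

  κ-+ : ∀ i u → κ o (i ℤ.+ + u) % P ≡ (κ o i + u) % P
  κ-+ i zero    = cong (_% P) (trans (cong (κ o) (ℤP.+-identityʳ i)) (sym (+-identityʳ (κ o i))))
  κ-+ i (suc u) = begin
    κ o (i ℤ.+ + suc u) % P       ≡⟨ cong (λ z → κ o z % P) i+[1+u]≡[i+u]+1 ⟩
    κ o ((i ℤ.+ + u) ℤ.+ 1ℤ) % P  ≡⟨ κ-suc (i ℤ.+ + u) ⟩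
    suc (κ o (i ℤ.+ + u)) % P     ≡⟨ %-cong-suc (κ-+ i u) ⟩
    suc (κ o i + u) % P           ≡⟨ cong (_% P) (+-suc (κ o i) u) ⟨
    (κ o i + suc u) % P           ∎
    where
      open ≡-Reasoning
      i+[1+u]≡[i+u]+1 : i ℤ.+ + suc u ≡ (i ℤ.+ + u) ℤ.+ 1ℤ
      i+[1+u]≡[i+u]+1 = trans (cong (λ z → i ℤ.+ z) (ℤP.+-comm 1ℤ (+ u))) (sym (ℤP.+-assoc i (+ u) 1ℤ))

module Cycle {A : Set} (d : A) (xs : List A) (o k : ℕ)
             (length-xs : length xs ≡ suc o + k) (wraps : left k xs ≡ right k xs) where

  P : ℕ
  P = suc o

  at-+P : ∀ t → t < k → at d xs (P + t) ≡ at d xs t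
  at-+P t t<k = begin
    at d xs (P + t)     ≡⟨ at-drop d xs P t ⟨
    at d (drop P xs) t  ≡⟨ cong (λ ys → at d ys t) take≡drop ⟨
    at d (take k xs) t  ≡⟨ at-take d xs t<k ⟩
    at d xs t           ∎
    where
      open ≡-Reasoning
      take≡drop : take k xs ≡ drop P xs
      take≡drop = trans wraps (cong (λ n → drop n xs) (trans (cong (_∸ k) length-xs) (m+n∸n≡m P k)))

  at-periodic : ∀ r q → r + q * P < P + k → at d xs (r + q * P) ≡ at d xs r
  at-periodic r zero    _  = cong (at d xs) (+-identityʳ r)
  at-periodic r (suc q) lt = begin
    at d xs (r + (P + q * P))  ≡⟨ cong (at d xs) (x∙yz≈y∙xz r P (q * P)) ⟩
    at d xs (P + (r + q * P))  ≡⟨ at-+P (r + q * P) r+qP<k ⟩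
    at d xs (r + q * P)        ≡⟨ at-periodic r q (<-trans r+qP<k (m<n+m k (s≤s z≤n))) ⟩
    at d xs r                  ∎
    where
      open ≡-Reasoning
      r+qP<k : r + q * P < k
      r+qP<k = +-cancelˡ-< P (r + q * P) k (subst (_< P + k) (x∙yz≈y∙xz r P (q * P)) lt)

  at-mod : ∀ s → s < P + k → at d xs s ≡ at d xs (s % P)
  at-mod s lt = trans (cong (at d xs) (m≡m%n+[m/n]*n s P))
                      (at-periodic (s % P) (s / P) (subst (_< P + k) (m≡m%n+[m/n]*n s P) lt))

  cycle : ℤ → A
  cycle i = at d xs (κ o i % P)

  cycle-+ : ∀ i u → u ≤ k → cycle (i ℤ.+ + u) ≡ at d xs (κ o i % P + u)
  cycle-+ i u u≤k = begin
    at d xs (κ o (i ℤ.+ + u) % P)  ≡⟨ cong (at d xs) (κ-+ o i u) ⟩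
    at d xs ((κ o i + u) % P)      ≡⟨ cong (at d xs) (%-absorbˡ-+ o (κ o i) u) ⟨
    at d xs ((κ o i % P + u) % P)  ≡⟨ at-mod (κ o i % P + u) (+-mono-<-≤ (m%n<n (κ o i) P) u≤k) ⟨
    at d xs (κ o i % P + u)        ∎
    where open ≡-Reasoning

  cycle-nonneg : ∀ s → s < P + k → cycle (+ s) ≡ at d xs s
  cycle-nonneg s lt = sym (at-mod s lt)

  τ₀-cycle : ∀ (f : Vec A (suc k) → A) i → τ₀ f cycle i ≡ localImage f (at d xs) (κ o i % P)
  τ₀-cycle f i = cong f (VP.tabulate-cong (λ j → cycle-+ i (toℕ j) (FP.toℕ≤pred[n] j)))

NoPeriodicLocalConfigs : ∀ {p m} → (Vec (S p) m → S p) → Set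
NoPeriodicLocalConfigs {p} f = ¬ ∃₂ λ (α β : List (S p)) → PeriodicLocalConfigs f α β

injective⇒noPLC : ∀ {p k} (f : Vec (S p) (suc k) → S p) → InjectiveCA (τ₀ f) → NoPeriodicLocalConfigs f
injective⇒noPLC {k = k} f inj (α@(x ∷ _) , β , lα , lβ , α≢β , wα , wβ , same) = α≢β α≡β
  where
    excess : ∀ {n} → suc k ≤ n → ∃ λ o → n ≡ suc o + k
    excess le with o , eq ← m≤n⇒∃[o]m+o≡n le = o , trans (sym eq) (cong suc (+-comm k o))

    o : ℕ
    o = proj₁ (excess lα)

    lenα : length α ≡ suc o + k
    lenα = proj₂ (excess lα)

    lenβ : length β ≡ suc o + k
    lenβ with o′ , lenβ′ ← excess lβ = trans lenβ′ (cong (_+ k) (begin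
      suc o′                  ≡⟨ length-successor f β o′ lenβ′ ⟨
      length (successor f β)  ≡⟨ cong length same ⟨
      length (successor f α)  ≡⟨ length-successor f α o lenα ⟩
      suc o                   ∎))
      where open ≡-Reasoning

    module Cα = Cycle x α o k lenα wα
    module Cβ = Cycle x β o k lenβ wβ

    localImages-agree : ∀ r → r < suc o → localImage f (at x α) r ≡ localImage f (at x β) r
    localImages-agree = slice-pointwise 0 0 (suc o)
      (trans (sym (successor-at f x α o lenα)) (trans same (successor-at f x β o lenβ)))

    cycles-agree : ∀ i → Cα.cycle i ≡ Cβ.cycle i
    cycles-agree = inj Cα.cycle Cβ.cycle λ i →
      trans (Cα.τ₀-cycle f i) (trans (localImages-agree _ (m%n<n (κ o i) (suc o))) (sym (Cβ.τ₀-cycle f i)))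

    α≡β : α ≡ β
    α≡β = trans (sym (slice-at x α lenα))
            (trans (slice-cong 0 0 (suc o + k) λ s lt →
                      trans (sym (Cα.cycle-nonneg s lt)) (trans (cycles-agree (+ s)) (Cβ.cycle-nonneg s lt)))
                   (slice-at x β lenβ))

module Agreement {p k} (f : Vec (S p) (suc k) → S p) (noPLC : NoPeriodicLocalConfigs f)
                 (C D : ℕ → S p) (same : ∀ a → localImage f C a ≡ localImage f D a) where

  successor-slice-cong : ∀ a n → successor f (slice C a (suc n + k)) ≡ successor f (slice D a (suc n + k))
  successor-slice-cong a n = begin
    successor f (slice C a (suc n + k))  ≡⟨ successor-slice f C a n ⟩
    slice (localImage f C) a (suc n)     ≡⟨ slice-cong a a (suc n) (λ t _ → same (a + t)) ⟩
    slice (localImage f D) a (suc n)     ≡⟨ successor-slice f D a n ⟨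
    successor f (slice D a (suc n + k))  ∎
    where open ≡-Reasoning

  agree-on-cycle : ∀ a e → slice C a k ≡ slice C (a + suc e) k → slice D a k ≡ slice D (a + suc e) k →
                   slice C a (suc e + k) ≡ slice D a (suc e + k)
  agree-on-cycle a e wC wD = decidable-stable (LP.≡-dec FP._≟_ _ _) λ C≢D →
    noPLC (_ , _ , long C , long D , C≢D ,
           left≡right-slice C a (suc e) k wC , left≡right-slice D a (suc e) k wD ,
           successor-slice-cong a e)
    where
      long : ∀ E → suc k ≤ length (slice E a (suc e + k))
      long E = ≤-length-slice E a (s≤s (m≤n+m k e))

  module _ (a e : ℕ) where

    closure : (ℕ → S p) → List (S p)
    closure E = slice E a (suc e + k) ++ slice E a k

    left≡right-closure : ∀ E → left k (closure E) ≡ right k (closure E)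
    left≡right-closure E = trans (take-slice-++ E a (slice E a k) (m≤n+m k (suc e)))
                                 (sym (right-slice-++ (slice E a (suc e + k)) E a k))

    successor-closure : ∀ E → successor f (closure E) ≡
                        successor f (slice E a (suc e + k)) ++ successor f (slice E (a + suc e) k ++ slice E a k)
    successor-closure E = begin
      successor f (slice E a (suc e + k) ++ zs)    ≡⟨ cong (λ w → successor f (w ++ zs)) (slice-+ E a (suc e) k) ⟩
      successor f ((xs ++ ys) ++ zs)               ≡⟨ cong (successor f) (LP.++-assoc xs ys zs) ⟩
      successor f (xs ++ ys ++ zs)                 ≡⟨ successor-++ f xs ys zs (length-slice E (a + suc e) k) ⟩
      successor f (xs ++ ys) ++ successor f (ys ++ zs)
        ≡⟨ cong (λ w → successor f w ++ successor f (ys ++ zs)) (slice-+ E a (suc e) k) ⟨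
      successor f (slice E a (suc e + k)) ++ successor f (ys ++ zs) ∎
      where
        open ≡-Reasoning
        xs ys zs : List (S p)
        xs = slice E a (suc e)
        ys = slice E (a + suc e) k
        zs = slice E a k

    agree-between : slice C a k ≡ slice D a k → slice C (a + suc e) k ≡ slice D (a + suc e) k →
                    slice C a (suc e) ≡ slice D a (suc e)
    agree-between wa wb = decidable-stable (LP.≡-dec FP._≟_ _ _) λ C≢D →
      noPLC (closure C , closure D , long C , long D ,
             (λ eq → C≢D (trans (sym (take-initial C)) (trans (cong (take (suc e)) eq) (take-initial D)))) ,
             left≡right-closure C , left≡right-closure D ,
             trans (successor-closure C)
               (trans (cong₂ _++_ (successor-slice-cong a e) (cong (successor f) (cong₂ _++_ wb wa)))
                      (sym (successor-closure D))))
      where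
        long : ∀ E → suc k ≤ length (closure E)
        long E = ≤-trans (≤-length-slice E a (s≤s (m≤n+m k e))) (LP.length-++-≤ˡ (slice E a (suc e + k)))
        take-initial : ∀ E → take (suc e) (closure E) ≡ slice E a (suc e)
        take-initial E = take-slice-++ E a (slice E a k) (m≤m+n (suc e) k)

  N : ℕ
  N = p ^ k * p ^ k

  windowCode : (ℕ → S p) → ℕ → Fin (p ^ k)
  windowCode E a = F.funToFin {m = k} (λ j → E (a + toℕ j))

  windowCode-injective : ∀ E a b → windowCode E a ≡ windowCode E b → slice E a k ≡ slice E b k
  windowCode-injective E a b eq = slice-cong a b k λ t t<k →
    subst (λ s → E (a + s) ≡ E (b + s)) (FP.toℕ-fromℕ< t<k) (pointwise (F.fromℕ< t<k))
    where
      pointwise : ∀ j → E (a + toℕ j) ≡ E (b + toℕ j)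
      pointwise j = begin
        E (a + toℕ j)                  ≡⟨ FP.finToFun-funToFin (λ j → E (a + toℕ j)) j ⟨
        F.finToFun (windowCode E a) j  ≡⟨ cong (λ c → F.finToFun {n = k} c j) eq ⟩
        F.finToFun (windowCode E b) j  ≡⟨ FP.finToFun-funToFin (λ j → E (b + toℕ j)) j ⟩
        E (b + toℕ j)                  ∎
        where open ≡-Reasoning

  windowPair : ℕ → Fin N
  windowPair a = F.combine (windowCode C a) (windowCode D a)

  agreeing-window : ∀ lo → ∃ λ a → lo ≤ a × a ≤ lo + N × slice C a k ≡ slice D a k
  agreeing-window lo with FP.pigeonhole (n<1+n N) (λ i → windowPair (lo + toℕ i))
  ... | i , j , i<j , same-pair with m≤n⇒∃[o]m+o≡n i<j
  ... | e , i+e≡j =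
    a , m≤m+n lo (toℕ i) , +-monoʳ-≤ lo (FP.toℕ≤pred[n] i) ,
    trans (sym (take-slice C a (m≤n+m k (suc e))))
          (trans (cong (take k) (agree-on-cycle a e wC wD)) (take-slice D a (m≤n+m k (suc e))))
    where
      a : ℕ
      a = lo + toℕ i
      j≡ : lo + toℕ j ≡ a + suc e
      j≡ = trans (cong (λ n → lo + n) (sym (trans (+-suc (toℕ i) e) i+e≡j))) (sym (+-assoc lo (toℕ i) (suc e)))
      codes : windowCode C a ≡ windowCode C (a + suc e) × windowCode D a ≡ windowCode D (a + suc e)
      codes = FP.combine-injective _ _ _ _ (trans same-pair (cong windowPair j≡))
      wC : slice C a k ≡ slice C (a + suc e) k
      wC = windowCode-injective C _ _ (proj₁ codes)
      wD : slice D a k ≡ slice D (a + suc e) k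
      wD = windowCode-injective D _ _ (proj₂ codes)

  agree-at-N : C N ≡ D N
  agree-at-N with agreeing-window 0 | agreeing-window (suc N)
  ... | a , _ , a≤N , wa | b , N<b , _ , wb
    with m≤n⇒∃[o]m+o≡n a≤N | m≤n⇒∃[o]m+o≡n (≤-trans (s≤s a≤N) N<b)
  ... | t , a+t≡N | e , a+e≡b =
    subst (λ n → C n ≡ D n) a+t≡N
      (slice-pointwise a a (suc e) (agree-between a e wa (subst (λ n → slice C n k ≡ slice D n k) b≡ wb)) t t<e)
    where
      b≡ : b ≡ a + suc e
      b≡ = trans (sym a+e≡b) (sym (+-suc a e))
      t<e : t < suc e
      t<e = +-cancelˡ-< a t (suc e) (subst₂ _<_ (sym a+t≡N) b≡ N<b)

noPLC⇒injective : ∀ {p k} (f : Vec (S p) (suc k) → S p) → NoPeriodicLocalConfigs f → InjectiveCA (τ₀ f)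
noPLC⇒injective {p} {k} f noPLC c d same i =
  subst (λ j → c j ≡ d j) (i-j+j≡i i (+ N)) (Agreement.agree-at-N f noPLC (from c) (from d) localImages-agree)
  where
    N : ℕ
    N = p ^ k * p ^ k
    from : (ℤ → S p) → ℕ → S p
    from e t = e (i ℤ.- + N ℤ.+ + t)
    localImage-from : ∀ e b → localImage f (from e) b ≡ τ₀ f e (i ℤ.- + N ℤ.+ + b)
    localImage-from e b = cong f (VP.tabulate-cong λ j → cong e (sym (ℤP.+-assoc (i ℤ.- + N) (+ b) (+ toℕ j))))
    localImages-agree : ∀ b → localImage f (from c) b ≡ localImage f (from d) b
    localImages-agree b = trans (localImage-from c b) (trans (same (i ℤ.- + N ℤ.+ + b)) (sym (localImage-from d b)))

τ₀-injective⇔noPLC : ∀ {p m} (f : Vec (S p) m → S p) → 1 ≤ m →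
                     InjectiveCA (τ₀ f) ⇔ NoPeriodicLocalConfigs f
τ₀-injective⇔noPLC f (s≤s z≤n) = mk⇔ (injective⇒noPLC f) (noPLC⇒injective f)

theorem2 : (p L R : ℕ) (f : Vec (S p) (nbhd L R) → S p) →
    InjectiveCA (τ L R f) ⇔ (¬ ∃₂ λ (α β : List (S p)) → PeriodicLocalConfigs f α β)
theorem2 p L R f = ⇔.trans (injectiveCA-shift (τ₀ f) (+ L)) (τ₀-injective⇔noPLC f 1≤m)
  where
    1≤m : 1 ≤ nbhd L R
    1≤m = ≤-trans (m≤n+m 1 L) (m≤m+n (L + 1) R)
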